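{- For each odd integer $k \geq 3$, $\mathrm{cms}(B_k)\leq \frac{k-1}{2}$ and $B_k$ has matching number $\frac{k+1}{2}$.
   Context: All graphs are finite and simple. For odd $k$, $B_k$ is the graph on $k+2$ vertices whose complement is the vertex-disjoint union of a path on $3$ vertices and a perfect matching on the remaining $k-1$ vertices. The matching number is the maximum size of a matching. For a graph $G$ with $m$ edges, an ordering is a bijection $\ell:E(G)\to\mathbb{Z}_m$; $d_\ell(e,e')$ is the smallest positive $d$ with $\ell(e)+d=\ell(e')$ in $\mathbb{Z}_m$, $d_\ell\{e,e'\}=\min\{d_\ell(e,e'),d_\ell(e',e)\}$; $\mathrm{cms}(\ell)$ is the largest $s\in\{1,\dots,m\}$ with $d_\ell\{e,e'\}\geq s$ for all pairs of adjacent (vertex-sharing) edges, and $\mathrm{cms}(G)$ is the maximum of $\mathrm{cms}(\ell)$ over all orderings of $G$. -}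

module Defs where

open import Data.Nat using (ℕ; zero; suc; _+_; _∸_; _≤_; _<_; _≡ᵇ_; _<ᵇ_; _%_)
open import Data.Nat.Properties using (≡⇒≡ᵇ)
open import Data.Bool using (Bool; true; false; T; not; _∧_; _∨_)
open import Data.Bool.Properties using (∨-comm)
open import Data.Fin as Fin using (Fin; toℕ)
open import Data.Product using (Σ; _×_; _,_; proj₁; proj₂; ∃)
open import Data.Sum using (_⊎_)
open import Data.List using (List; length)
open import Data.List.Relation.Unary.AllPairs using (AllPairs)
open import Function.Bundles using (_⤖_; Bijection)
open import Relation.Nullary using (¬_)
open import Relation.Binary.PropositionalEquality using (_≡_; refl; cong)

record SimpleGraph (n : ℕ) : Set where
  field
    adj     : Fin n → Fin n → Bool
    adj-sym : ∀ u v → adj u v ≡ adj v u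
    irrefl  : ∀ u → adj u u ≡ false

open SimpleGraph public

-- An edge is an unordered pair {u,v}, represented canonically with u < v.
Edge : ∀ {n} → SimpleGraph n → Set
Edge {n} G = Σ (Fin n × Fin n) λ p → (proj₁ p Fin.< proj₂ p) × T (adj G (proj₁ p) (proj₂ p))

src tgt : ∀ {n} {G : SimpleGraph n} → Edge G → Fin n
src ((u , _) , _) = u
tgt ((_ , v) , _) = v

AdjEdges : ∀ {n} {G : SimpleGraph n} → Edge G → Edge G → Set
AdjEdges {G = G} e e' =
  ¬ (e ≡ e') ×
  ((src {G = G} e ≡ src {G = G} e') ⊎ (src {G = G} e ≡ tgt {G = G} e') ⊎
   (tgt {G = G} e ≡ src {G = G} e') ⊎ (tgt {G = G} e ≡ tgt {G = G} e'))

-- Cyclic distance in ℤ_m (elements of ℤ_m represented by Fin m).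
-- dist a b = smallest positive d with a + d ≡ b (mod m); this equals
-- ((b - a - 1) mod m) + 1, which lies in {1,…,m} (= m iff a = b).

dist : ∀ {m} → Fin m → Fin m → ℕ
dist {suc m} a b = suc ((toℕ b + suc m ∸ suc (toℕ a)) % suc m)

DistAtLeast : ∀ {m} → Fin m → Fin m → ℕ → Set
DistAtLeast a b s = (s ≤ dist a b) × (s ≤ dist b a)

-- An ordering of G is a bijection E(G) → ℤ_m; the target size m is then
-- forced to be |E(G)|.
Ordering : ∀ {n} → SimpleGraph n → ℕ → Set
Ordering G m = Edge G ⤖ Fin m

Separated : ∀ {n} {G : SimpleGraph n} {m} → Ordering G m → ℕ → Set
Separated {G = G} ℓ s =
  ∀ (e e' : Edge G) → AdjEdges {G = G} e e' →
    DistAtLeast (Bijection.to ℓ e) (Bijection.to ℓ e') s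

-- cms(ℓ) ≤ t : the largest s ∈ {1,…,m} with ℓ s-separated is at most t.
CmsOrderingAtMost : ∀ {n} {G : SimpleGraph n} {m} → Ordering G m → ℕ → Set
CmsOrderingAtMost {G = G} {m} ℓ t =
  ∀ s → 1 ≤ s → s ≤ m → Separated {G = G} ℓ s → s ≤ t

CmsAtMost : ∀ {n} → SimpleGraph n → ℕ → Set
CmsAtMost G t = ∀ m (ℓ : Ordering G m) → CmsOrderingAtMost {G = G} ℓ t

Disjoint : ∀ {n} {G : SimpleGraph n} → Edge G → Edge G → Set
Disjoint {G = G} e e' =
  ¬ (src {G = G} e ≡ src {G = G} e') × ¬ (src {G = G} e ≡ tgt {G = G} e') ×
  ¬ (tgt {G = G} e ≡ src {G = G} e') × ¬ (tgt {G = G} e ≡ tgt {G = G} e')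

IsMatching : ∀ {n} {G : SimpleGraph n} → List (Edge G) → Set
IsMatching {G = G} M = AllPairs (Disjoint {G = G}) M

MatchingNumber : ∀ {n} → SimpleGraph n → ℕ → Set
MatchingNumber G ν =
  (Σ (List (Edge G)) λ M → IsMatching {G = G} M × length M ≡ ν) ×
  (∀ (M : List (Edge G)) → IsMatching {G = G} M → length M ≤ ν)

-- The graph B_k on vertices {0,…,k+1}.  Complement: the path 0 – 1 – 2
-- and the perfect matching {3,4}, {5,6}, …, {k,k+1} on the rest.

complDir : ℕ → ℕ → Bool
complDir x y =
  ((x ≡ᵇ 0) ∧ (y ≡ᵇ 1)) ∨ ((x ≡ᵇ 1) ∧ (y ≡ᵇ 2)) ∨
  ((2 <ᵇ x) ∧ ((x % 2) ≡ᵇ 1) ∧ (y ≡ᵇ suc x))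

complB : ℕ → ℕ → Bool
complB x y = complDir x y ∨ complDir y x

adjB : ℕ → ℕ → Bool
adjB x y = not (x ≡ᵇ y) ∧ not (complB x y)

private
  ≡ᵇ-sym : ∀ x y → (x ≡ᵇ y) ≡ (y ≡ᵇ x)
  ≡ᵇ-sym zero zero = refl
  ≡ᵇ-sym zero (suc y) = refl
  ≡ᵇ-sym (suc x) zero = refl
  ≡ᵇ-sym (suc x) (suc y) = ≡ᵇ-sym x y

  ≡ᵇ-refl : ∀ x → (x ≡ᵇ x) ≡ true
  ≡ᵇ-refl zero = refl
  ≡ᵇ-refl (suc x) = ≡ᵇ-refl x

  adjB-sym : ∀ x y → adjB x y ≡ adjB y x
  adjB-sym x y rewrite ≡ᵇ-sym x y | ∨-comm (complDir x y) (complDir y x) = refl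

  adjB-irrefl : ∀ x → adjB x x ≡ false
  adjB-irrefl x rewrite ≡ᵇ-refl x = refl

B : (k : ℕ) → SimpleGraph (k + 2)
B k = record
  { adj     = λ u v → adjB (toℕ u) (toℕ v)
  ; adj-sym = λ u v → adjB-sym (toℕ u) (toℕ v)
  ; irrefl  = λ u → adjB-irrefl (toℕ u)
  }

-- Write k = 2t + 1, so B_k has 2t + 3 vertices and 2t² + 4t + 1 edges.  If an
-- ordering is (t+1)-separated, any t + 1 consecutive edges form a matching and so
-- cover 2t + 2 vertices, and the next edge meets a vertex outside the first one;
-- hence every window of t + 2 consecutive positions contains an edge at every
-- vertex.  Vertex 1 has only 2t neighbours, yet one of its edges together with
-- one from each of the 2t windows of length t + 2 that follow it gives 2t + 1
-- distinct edges at vertex 1, as these 2t(t + 2) + 1 positions do not wrap around.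
-- For the matching number, the edges {x, x + t + 1} with x ≤ t form a matching,
-- and no matching on 2t + 3 vertices has more than t + 1 edges.

module Submission where

open import Defs
open import Data.Nat using (ℕ; zero; suc; _+_; _*_; _∸_; _/_; _%_; _≤_; _<_; z≤n; s≤s; s≤s⁻¹; NonZero)
open import Data.Nat.Properties
open import Data.Nat.DivMod using (m*n%n≡0; _mod_; m%n<n; m<n⇒m%n≡m; %-distribˡ-+; [m+n]%n≡m%n; m≤n⇒[n∸m]%m≡n%m; m*n/n≡m; m≡m%n+[m/n]*n)
open import Data.Nat.Tactic.RingSolver using (solve-∀)
open import Data.Bool using (T; true; false)
open import Data.Bool.Properties using (T-irrelevant; T-∧; T-∨)
open import Function using (_∘_)
open import Data.Fin as Fin using (Fin; toℕ; fromℕ<)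
open import Data.Fin.Properties using (injective⇒≤; toℕ-fromℕ<)
open import Data.Product using (∃-syntax; _×_; _,_; proj₁; proj₂)
open import Data.Sum using (_⊎_; inj₁; inj₂)
open import Data.Empty using (⊥; ⊥-elim)
open import Data.Unit using (tt)
open import Data.List using (List; []; _∷_; _++_; length; lookup; map)
open import Data.List.Properties using (length-map; length-++)
open import Data.List.Membership.Propositional.Properties using (∈-lookup)
open import Data.List.Relation.Unary.All as All using (All; []; _∷_)
import Data.List.Relation.Unary.All.Properties as All
open import Data.List.Relation.Unary.AllPairs using (AllPairs; []; _∷_)
import Data.List.Relation.Unary.AllPairs.Properties as AllPairs
open import Data.List.Relation.Unary.Unique.Propositional using (Unique)
import Data.List.Relation.Unary.Unique.Propositional.Properties as Unique
open import Function.Bundles using (Bijection; Equivalence)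
open import Function.Definitions using (Injective)
open import Relation.Nullary using (¬_; Dec; yes; no; contradiction)
open import Relation.Nullary.Decidable using (_⊎-dec_)
open import Relation.Binary.PropositionalEquality

Unique-lookup-injective : ∀ {A : Set} {xs : List A} → Unique xs → Injective _≡_ _≡_ (lookup xs)
Unique-lookup-injective (_ ∷ _) {Fin.zero} {Fin.zero} _ = refl
Unique-lookup-injective (x∉xs ∷ _) {Fin.zero} {Fin.suc j} eq = contradiction eq (All.lookup x∉xs (∈-lookup j))
Unique-lookup-injective (x∉xs ∷ _) {Fin.suc i} {Fin.zero} eq = contradiction (sym eq) (All.lookup x∉xs (∈-lookup i))
Unique-lookup-injective (_ ∷ u) {Fin.suc i} {Fin.suc j} eq = cong Fin.suc (Unique-lookup-injective u eq)

Unique-length≤ : ∀ {n} {xs : List (Fin n)} → Unique xs → length xs ≤ n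
Unique-length≤ u = injective⇒≤ (Unique-lookup-injective u)

AllPairs-map-within : ∀ {A : Set} {P : A → Set} {R S : A → A → Set} {xs : List A} →
  (∀ {x y} → P x → P y → R x y → S x y) → All P xs → AllPairs R xs → AllPairs S xs
AllPairs-map-within f [] [] = []
AllPairs-map-within f (px ∷ pxs) (rx ∷ rxs) =
  All.zipWith (λ (py , r) → f px py r) (pxs , rx) ∷ AllPairs-map-within f pxs rxs

All-All-≢ : ∀ {A B : Set} (f : A → B) {P Q : B → Set} {xs ys : List A} →
  All (P ∘ f) xs → All (Q ∘ f) ys → (∀ {a b} → P a → Q b → a ≢ b) → All (λ x → All (x ≢_) ys) xs
All-All-≢ f pxs qys P⇒Q⇒≢ = All.map (λ px → All.map (λ qy x≡y → P⇒Q⇒≢ px qy (cong f x≡y)) qys) pxs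

¬T⇒≡false : ∀ {b} → ¬ T b → b ≡ false
¬T⇒≡false {false} _  = refl
¬T⇒≡false {true}  ¬t = contradiction tt ¬t

n+n≡n*2 : ∀ n → n + n ≡ n * 2
n+n≡n*2 = solve-∀

m+m≤1+n+n⇒m≤n : ∀ m n → m + m ≤ suc (n + n) → m ≤ n
m+m≤1+n+n⇒m≤n zero    n       _ = z≤n
m+m≤1+n+n⇒m≤n (suc m) zero    (s≤s m+1+m≤0) = contradiction (subst (_≤ 0) (+-suc m m) m+1+m≤0) λ ()
m+m≤1+n+n⇒m≤n (suc m) (suc n) (s≤s le) =
  s≤s (m+m≤1+n+n⇒m≤n m n (s≤s⁻¹ (subst₂ _≤_ (+-suc m m) (cong suc (+-suc n n)) le)))

-- Cyclic distance in ℤ_(suc m)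

dist-self : ∀ {m} (a : Fin (suc m)) → dist a a ≡ suc m
dist-self {m} a = cong suc (begin
  (toℕ a + suc m ∸ suc (toℕ a)) % suc m ≡⟨ cong (λ z → (z ∸ suc (toℕ a)) % suc m) (+-suc (toℕ a) m) ⟩
  (suc (toℕ a) + m ∸ suc (toℕ a)) % suc m ≡⟨ cong (_% suc m) (m+n∸m≡n (suc (toℕ a)) m) ⟩
  m % suc m                               ≡⟨ m<n⇒m%n≡m (n<1+n m) ⟩
  m                                       ∎)
  where open ≡-Reasoning

[[a+1+d]%n+n∸[1+a]]%n≡d : ∀ n a d .{{_ : NonZero n}} → a < n → suc d < n →
  ((a + suc d) % n + n ∸ suc a) % n ≡ d
[[a+1+d]%n+n∸[1+a]]%n≡d n a d a<n d<n with a + suc d <? n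
... | yes a+d<n = begin
  ((a + suc d) % n + n ∸ suc a) % n ≡⟨ cong (λ z → (z + n ∸ suc a) % n) (m<n⇒m%n≡m a+d<n) ⟩
  (a + suc d + n ∸ suc a) % n       ≡⟨ cong (λ z → (z ∸ suc a) % n) (trans (+-assoc a (suc d) n) (+-suc a (d + n))) ⟩
  (suc a + (d + n) ∸ suc a) % n     ≡⟨ cong (_% n) (m+n∸m≡n (suc a) (d + n)) ⟩
  (d + n) % n                       ≡⟨ [m+n]%n≡m%n d n ⟩
  d % n                             ≡⟨ m<n⇒m%n≡m (<-trans (n<1+n d) d<n) ⟩
  d                                 ∎
  where open ≡-Reasoning
... | no a+d≮n = begin
  ((a + suc d) % n + n ∸ suc a) % n       ≡⟨ cong (λ z → (z + n ∸ suc a) % n) (sym (m≤n⇒[n∸m]%m≡n%m n≤a+d)) ⟩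
  ((a + suc d ∸ n) % n + n ∸ suc a) % n   ≡⟨ cong (λ z → (z + n ∸ suc a) % n) (m<n⇒m%n≡m a+d∸n<n) ⟩
  ((a + suc d ∸ n) + n ∸ suc a) % n       ≡⟨ cong (λ z → (z ∸ suc a) % n) (m∸n+n≡m n≤a+d) ⟩
  (a + suc d ∸ suc a) % n                 ≡⟨ cong (λ z → (z ∸ suc a) % n) (+-suc a d) ⟩
  (suc a + d ∸ suc a) % n                 ≡⟨ cong (_% n) (m+n∸m≡n (suc a) d) ⟩
  d % n                                   ≡⟨ m<n⇒m%n≡m (<-trans (n<1+n d) d<n) ⟩
  d                                       ∎
  where
  open ≡-Reasoning
  n≤a+d : n ≤ a + suc d
  n≤a+d = ≮⇒≥ a+d≮n
  a+d∸n<n : a + suc d ∸ n < n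
  a+d∸n<n = subst (a + suc d ∸ n <_) (m+n∸n≡m n n) (∸-monoˡ-< (+-mono-< a<n d<n) n≤a+d)

dist-mod-+ : ∀ {m} x d → suc d < suc m → dist (x mod suc m) ((x + suc d) mod suc m) ≡ suc d
dist-mod-+ {m} x d d<n rewrite toℕ-fromℕ< (m%n<n (x + suc d) (suc m)) | toℕ-fromℕ< (m%n<n x (suc m)) =
  cong suc (begin
    ((x + suc d) % n + n ∸ suc (x % n)) % n          ≡⟨ cong (λ z → (z + n ∸ suc (x % n)) % n) x+d≡[x%n]+d ⟩
    ((x % n + suc d) % n + n ∸ suc (x % n)) % n      ≡⟨ [[a+1+d]%n+n∸[1+a]]%n≡d n (x % n) d (m%n<n x n) d<n ⟩
    d                                                ∎)
  where
  open ≡-Reasoning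
  n : ℕ
  n = suc m
  x+d≡[x%n]+d : (x + suc d) % n ≡ (x % n + suc d) % n
  x+d≡[x%n]+d = trans (%-distribˡ-+ x (suc d) n) (cong (λ z → (x % n + z) % n) (m<n⇒m%n≡m d<n))

mod-+-≢ : ∀ {m} x d → suc d < suc m → x mod suc m ≢ (x + suc d) mod suc m
mod-+-≢ {m} x d d<n eq = <-irrefl (begin
  suc d                                            ≡⟨ sym (dist-mod-+ x d d<n) ⟩
  dist (x mod suc m) ((x + suc d) mod suc m)       ≡⟨ cong (dist (x mod suc m)) (sym eq) ⟩
  dist (x mod suc m) (x mod suc m)                 ≡⟨ dist-self (x mod suc m) ⟩
  suc m                                            ∎) d<n
  where open ≡-Reasoning

-- Edges and matchings of a simple graph

module _ {n} {G : SimpleGraph n} where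

  Incident : Fin n → Edge G → Set
  Incident v e = v ≡ src {G = G} e ⊎ v ≡ tgt {G = G} e

  incident? : ∀ v e → Dec (Incident v e)
  incident? v e = v Fin.≟ src {G = G} e ⊎-dec v Fin.≟ tgt {G = G} e

  Edge-≡ : ∀ {e e' : Edge G} → src {G = G} e ≡ src {G = G} e' → tgt {G = G} e ≡ tgt {G = G} e' → e ≡ e'
  Edge-≡ {(u , v) , u<v , uv} {(.u , .v) , u<v' , uv'} refl refl
    rewrite <-irrelevant u<v u<v' | T-irrelevant uv uv' = refl

  src<tgt : (e : Edge G) → toℕ (src {G = G} e) < toℕ (tgt {G = G} e)
  src<tgt (_ , u<v , _) = u<v

  src≢tgt : (e : Edge G) → src {G = G} e ≢ tgt {G = G} e
  src≢tgt e eq = <-irrefl (cong toℕ eq) (src<tgt e)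

  Disjoint-sym : ∀ {e e' : Edge G} → Disjoint {G = G} e e' → Disjoint {G = G} e' e
  Disjoint-sym (ss , st , ts , tt′) =
    (λ eq → ss (sym eq)) , (λ eq → ts (sym eq)) , (λ eq → st (sym eq)) , (λ eq → tt′ (sym eq))

  ¬AdjEdges⇒Disjoint : ∀ {e e' : Edge G} → e ≢ e' → ¬ AdjEdges {G = G} e e' → Disjoint {G = G} e e'
  ¬AdjEdges⇒Disjoint e≢e' ¬adj =
    (λ eq → ¬adj (e≢e' , inj₁ eq)) , (λ eq → ¬adj (e≢e' , inj₂ (inj₁ eq))) ,
    (λ eq → ¬adj (e≢e' , inj₂ (inj₂ (inj₁ eq)))) , (λ eq → ¬adj (e≢e' , inj₂ (inj₂ (inj₂ eq))))

  Disjoint-crossing : ∀ {e e' : Edge G} →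
    toℕ (src {G = G} e) < toℕ (src {G = G} e') → toℕ (src {G = G} e') < toℕ (tgt {G = G} e) →
    toℕ (tgt {G = G} e) < toℕ (tgt {G = G} e') → Disjoint {G = G} e e'
  Disjoint-crossing {e} {e'} s<s' s'<t t<t' =
    (λ eq → <-irrefl (cong toℕ eq) s<s') ,
    (λ eq → <-irrefl (cong toℕ eq) (<-trans s<s' (src<tgt e'))) ,
    (λ eq → <-irrefl (cong toℕ (sym eq)) s'<t) ,
    (λ eq → <-irrefl (cong toℕ eq) t<t')

  Disjoint⇒¬Incident : ∀ {v} {e e' : Edge G} → Disjoint {G = G} e e' → Incident v e' → ¬ Incident v e
  Disjoint⇒¬Incident (ss , st , ts , tt′) (inj₁ refl) (inj₁ eq) = ss (sym eq)
  Disjoint⇒¬Incident (ss , st , ts , tt′) (inj₁ refl) (inj₂ eq) = ts (sym eq)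
  Disjoint⇒¬Incident (ss , st , ts , tt′) (inj₂ refl) (inj₁ eq) = st (sym eq)
  Disjoint⇒¬Incident (ss , st , ts , tt′) (inj₂ refl) (inj₂ eq) = tt′ (sym eq)

  ∃-incident-¬incident : ∀ {e e' : Edge G} → e' ≢ e → ∃[ w ] Incident w e' × ¬ Incident w e
  ∃-incident-¬incident {e} {e'} e'≢e with incident? (src {G = G} e') e | incident? (tgt {G = G} e') e
  ... | no ¬i | _     = src {G = G} e' , inj₁ refl , ¬i
  ... | yes _ | no ¬i = tgt {G = G} e' , inj₂ refl , ¬i
  ... | yes i | yes j = ⊥-elim (both-incident i j)
    where
    both-incident : Incident (src {G = G} e') e → Incident (tgt {G = G} e') e → ⊥
    both-incident (inj₁ s'≡s) (inj₁ t'≡s) = src≢tgt e' (trans s'≡s (sym t'≡s))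
    both-incident (inj₂ s'≡t) (inj₂ t'≡t) = src≢tgt e' (trans s'≡t (sym t'≡t))
    both-incident (inj₁ s'≡s) (inj₂ t'≡t) = e'≢e (Edge-≡ s'≡s t'≡t)
    both-incident (inj₂ s'≡t) (inj₁ t'≡s) =
      <-asym (src<tgt e) (subst₂ _<_ (cong toℕ s'≡t) (cong toℕ t'≡s) (src<tgt e'))

  endpoints : List (Edge G) → List (Fin n)
  endpoints []       = []
  endpoints (e ∷ es) = src {G = G} e ∷ tgt {G = G} e ∷ endpoints es

  length-endpoints : ∀ es → length (endpoints es) ≡ length es + length es
  length-endpoints []       = refl
  length-endpoints (e ∷ es) = cong suc (trans (cong suc (length-endpoints es)) (sym (+-suc (length es) (length es))))

  ¬Incident⇒∉endpoints : ∀ {v} {es} → All (λ e → ¬ Incident v e) es → All (v ≢_) (endpoints es)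
  ¬Incident⇒∉endpoints []           = []
  ¬Incident⇒∉endpoints (¬i ∷ ¬is) =
    (λ eq → ¬i (inj₁ eq)) ∷ (λ eq → ¬i (inj₂ eq)) ∷ ¬Incident⇒∉endpoints ¬is

  IsMatching⇒Unique-endpoints : ∀ {es} → IsMatching {G = G} es → Unique (endpoints es)
  IsMatching⇒Unique-endpoints {[]}     []         = []
  IsMatching⇒Unique-endpoints {e ∷ es} (ds ∷ dss) =
    (src≢tgt e ∷ ¬Incident⇒∉endpoints (All.map (λ (ss , st , _ , _) → λ { (inj₁ eq) → ss eq ; (inj₂ eq) → st eq }) ds)) ∷
    ¬Incident⇒∉endpoints (All.map (λ (_ , _ , ts , tt′) → λ { (inj₁ eq) → ts eq ; (inj₂ eq) → tt′ eq }) ds) ∷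
    IsMatching⇒Unique-endpoints dss

  IsMatching⇒length≤ : ∀ {es} → IsMatching {G = G} es → length es + length es ≤ n
  IsMatching⇒length≤ {es} matching =
    subst (_≤ n) (length-endpoints es) (Unique-length≤ (IsMatching⇒Unique-endpoints matching))

-- Separated orderings

module _ {n} {G : SimpleGraph n} where

  Separated-mono : ∀ {m} {ℓ : Ordering G m} {s s'} → s ≤ s' → Separated {G = G} ℓ s' → Separated {G = G} ℓ s
  Separated-mono s≤s' sep e e' adj = ≤-trans s≤s' (proj₁ (sep e e' adj)) , ≤-trans s≤s' (proj₂ (sep e e' adj))

  Unique-length≤ordering : ∀ {m} (ℓ : Ordering G m) {es : List (Edge G)} → Unique es → length es ≤ m
  Unique-length≤ordering {m} ℓ {es} u =
    subst (_≤ m) (length-map (Bijection.to ℓ) es) (Unique-length≤ (Unique.map⁺ (Bijection.injective ℓ) u))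

module Window {n} {G : SimpleGraph n} {m} (ℓ : Ordering G (suc m))
              {s} (sep : Separated {G = G} ℓ s) (0<s : 0 < s) (s<m : s < suc m) where

  edgeAt : ℕ → Edge G
  edgeAt x = proj₁ (Bijection.surjective ℓ (x mod suc m))

  to-edgeAt : ∀ x → Bijection.to ℓ (edgeAt x) ≡ x mod suc m
  to-edgeAt x = proj₂ (Bijection.surjective ℓ (x mod suc m)) refl

  private
    offset : ∀ {x y} → x < y → ∃[ d ] y ≡ x + suc d
    offset {x} x<y with m≤n⇒∃[o]m+o≡n x<y
    ... | d , refl = d , sym (+-suc x d)

  edgeAt-≢ : ∀ {x y} → x < y → y < x + suc m → edgeAt x ≢ edgeAt y
  edgeAt-≢ {x} x<y y<x+m eq with offset x<y
  ... | d , refl = mod-+-≢ x d (+-cancelˡ-< x _ _ y<x+m)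
    (trans (sym (to-edgeAt x)) (trans (cong (Bijection.to ℓ) eq) (to-edgeAt (x + suc d))))

  edgeAt-disjoint : ∀ {x y} → x < y → y < x + s → Disjoint {G = G} (edgeAt x) (edgeAt y)
  edgeAt-disjoint {x} x<y y<x+s with offset x<y
  ... | d , refl = ¬AdjEdges⇒Disjoint {G = G} (edgeAt-≢ x<y (<-trans y<x+s (+-monoʳ-< x s<m))) λ adj →
    <⇒≱ d<s (begin
      s                                                        ≤⟨ proj₁ (sep _ _ adj) ⟩
      dist (Bijection.to ℓ (edgeAt x)) (Bijection.to ℓ (edgeAt (x + suc d)))
                                                               ≡⟨ cong₂ dist (to-edgeAt x) (to-edgeAt (x + suc d)) ⟩
      dist (x mod suc m) ((x + suc d) mod suc m)               ≡⟨ dist-mod-+ x d (<-trans d<s s<m) ⟩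
      suc d                                                    ∎)
    where
    open ≤-Reasoning
    d<s : suc d < s
    d<s = +-cancelˡ-< x _ _ y<x+s

  window : ℕ → ℕ → List (Edge G)
  window x zero    = []
  window x (suc c) = edgeAt (x + c) ∷ window x c

  length-window : ∀ x c → length (window x c) ≡ c
  length-window x zero    = refl
  length-window x (suc c) = cong suc (length-window x c)

  All-window : ∀ {P : Edge G → Set} x c → (∀ i → i < c → P (edgeAt (x + i))) → All P (window x c)
  All-window x zero    _ = []
  All-window x (suc c) f = f c ≤-refl ∷ All-window x c (λ i i<c → f i (m<n⇒m<1+n i<c))

  window-matching : ∀ x c → c ≤ s → IsMatching {G = G} (window x c)
  window-matching x zero    _   = []
  window-matching x (suc c) c<s =
    All-window x c (λ i i<c → Disjoint-sym {G = G} {edgeAt (x + i)} {edgeAt (x + c)}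
                                (edgeAt-disjoint (+-monoʳ-< x i<c) (x+c<x+i+s i))) ∷
    window-matching x c (<⇒≤ c<s)
    where
    x+c<x+i+s : ∀ i → x + c < x + i + s
    x+c<x+i+s i = subst (x + c <_) (sym (+-assoc x i s)) (+-monoʳ-< x (<-≤-trans c<s (m≤n+m s i)))

  edgeAt-Unique : ∀ {lo} {ps} → AllPairs _<_ ps → All (λ q → lo ≤ q × q < lo + suc m) ps → Unique (map edgeAt ps)
  edgeAt-Unique {lo} increasing range =
    AllPairs.map⁺ (AllPairs-map-within
      (λ (lo≤x , _) (_ , y<lo+m) x<y → edgeAt-≢ x<y (<-≤-trans y<lo+m (+-monoˡ-≤ (suc m) lo≤x)))
      range increasing)

  module _ (n≤2s+1 : n ≤ suc (s + s)) where

    window-covers : ∀ x v → ∃[ i ] i ≤ s × Incident {G = G} v (edgeAt (x + i))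
    window-covers x v with anyUpTo? (λ i → incident? {G = G} v (edgeAt (x + i))) (suc s)
    ... | yes (i , i<1+s , inc) = i , s≤s⁻¹ i<1+s , inc
    ... | no ¬covered = contradiction (Unique-length≤ vs-unique) (<⇒≱ (subst (n <_) (sym length-vs) (s≤s n≤2s+1)))
      where
      e₀ e : Edge G
      e₀ = edgeAt (x + 0)
      e  = edgeAt (x + s)

      e≢e₀ : e ≢ e₀
      e≢e₀ = ≢-sym (edgeAt-≢ (+-monoʳ-< x 0<s)
                    (subst (λ z → x + s < z + suc m) (sym (+-identityʳ x)) (+-monoʳ-< x s<m)))

      w : Fin n
      w = proj₁ (∃-incident-¬incident {G = G} e≢e₀)

      w∈e : Incident {G = G} w e
      w∈e = proj₁ (proj₂ (∃-incident-¬incident {G = G} e≢e₀))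

      v-avoids : ∀ i → i < s → ¬ Incident {G = G} v (edgeAt (x + i))
      v-avoids i i<s inc = ¬covered (i , m<n⇒m<1+n i<s , inc)

      w∉e₀ : ¬ Incident {G = G} w e₀
      w∉e₀ = proj₂ (proj₂ (∃-incident-¬incident {G = G} e≢e₀))

      w-avoids : ∀ i → i < s → ¬ Incident {G = G} w (edgeAt (x + i))
      w-avoids zero    _   = w∉e₀
      w-avoids (suc i) i<s = Disjoint⇒¬Incident {G = G} {e = edgeAt (x + suc i)} {e' = e}
        (edgeAt-disjoint (+-monoʳ-< x i<s) (+-monoˡ-< s (m<m+n x (s≤s z≤n)))) w∈e

      v≢w : v ≢ w
      v≢w refl = ¬covered (s , n<1+n s , w∈e)

      vs : List (Fin n)
      vs = v ∷ w ∷ endpoints {G = G} (window x s)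

      vs-unique : Unique vs
      vs-unique =
        (v≢w ∷ ¬Incident⇒∉endpoints (All-window x s v-avoids)) ∷
        ¬Incident⇒∉endpoints (All-window x s w-avoids) ∷
        IsMatching⇒Unique-endpoints (window-matching x s ≤-refl)

      length-vs : length vs ≡ suc (suc (s + s))
      length-vs = cong (suc ∘ suc) (trans (length-endpoints (window x s)) (cong₂ _+_ (length-window x s) (length-window x s)))

    incidentPositions : Fin n → ℕ → ℕ → List ℕ
    incidentPositions v x zero    = []
    incidentPositions v x (suc c) = x + proj₁ (window-covers x v) ∷ incidentPositions v (suc (x + proj₁ (window-covers x v))) c

    length-incidentPositions : ∀ v x c → length (incidentPositions v x c) ≡ c
    length-incidentPositions v x zero    = refl
    length-incidentPositions v x (suc c) = cong suc (length-incidentPositions v _ c)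

    incidentPositions-incident : ∀ v x c → All (λ q → Incident {G = G} v (edgeAt q)) (incidentPositions v x c)
    incidentPositions-incident v x zero    = []
    incidentPositions-incident v x (suc c) = proj₂ (proj₂ (window-covers x v)) ∷ incidentPositions-incident v _ c

    incidentPositions-range : ∀ v x c → All (λ q → x ≤ q × q < x + c * suc s) (incidentPositions v x c)
    incidentPositions-range v x zero    = []
    incidentPositions-range v x (suc c) =
      (m≤m+n x i , +-monoʳ-< x (<-≤-trans (s≤s i≤s) (m≤m+n (suc s) (c * suc s)))) ∷
      All.map (λ (x'≤q , q<x'+cs) → ≤-trans (m≤m+n x i) (<⇒≤ x'≤q) , <-≤-trans q<x'+cs x'+cs≤x+[1+c]s)
              (incidentPositions-range v (suc (x + i)) c)
      where
      i : ℕ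
      i = proj₁ (window-covers x v)
      i≤s : i ≤ s
      i≤s = proj₁ (proj₂ (window-covers x v))
      x'+cs≤x+[1+c]s : suc (x + i) + c * suc s ≤ x + suc c * suc s
      x'+cs≤x+[1+c]s = begin
        suc (x + i) + c * suc s   ≡⟨ cong (_+ c * suc s) (sym (+-suc x i)) ⟩
        x + suc i + c * suc s     ≤⟨ +-monoˡ-≤ (c * suc s) (+-monoʳ-≤ x (s≤s i≤s)) ⟩
        x + suc s + c * suc s     ≡⟨ +-assoc x (suc s) (c * suc s) ⟩
        x + suc c * suc s         ∎
        where open ≤-Reasoning

    incidentPositions-increasing : ∀ v x c → AllPairs _<_ (incidentPositions v x c)
    incidentPositions-increasing v x zero    = []
    incidentPositions-increasing v x (suc c) =
      All.map proj₁ (incidentPositions-range v _ c) ∷ incidentPositions-increasing v _ c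

    incident-edges : ∀ c → c * suc s < suc m → ∀ v →
      ∃[ es ] Unique es × All (Incident {G = G} v) es × length es ≡ suc c
    incident-edges c cs<m v =
      map edgeAt ps ,
      edgeAt-Unique {lo = p} (All.map proj₁ rest-range ∷ incidentPositions-increasing v (suc p) c)
        ((≤-refl , m<m+n p (s≤s z≤n)) ∷ All.map (λ (p<q , q<) → <⇒≤ p<q , <-≤-trans q< bound) rest-range) ,
      All.map⁺ incidences ,
      trans (length-map edgeAt ps) (cong suc (length-incidentPositions v (suc p) c))
      where
      p : ℕ
      p = proj₁ (window-covers 0 v)
      ps : List ℕ
      ps = p ∷ incidentPositions v (suc p) c
      incidences : All (λ q → Incident {G = G} v (edgeAt q)) ps
      incidences = proj₂ (proj₂ (window-covers 0 v)) ∷ incidentPositions-incident v (suc p) c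
      rest-range : All (λ q → suc p ≤ q × q < suc p + c * suc s) (incidentPositions v (suc p) c)
      rest-range = incidentPositions-range v (suc p) c
      bound : suc p + c * suc s ≤ p + suc m
      bound = subst (_≤ p + suc m) (+-suc p (c * suc s)) (+-monoʳ-≤ p cs<m)

-- The graph B_k

complDir-spec : ∀ x y → T (complDir x y) →
  (x ≡ 0 × y ≡ 1) ⊎ (x ≡ 1 × y ≡ 2) ⊎ (2 < x × x % 2 ≡ 1 × y ≡ suc x)
complDir-spec x y c with Equivalence.to T-∨ c
... | inj₁ c₀₁ = let (x≡0 , y≡1) = Equivalence.to T-∧ c₀₁ in
  inj₁ (≡ᵇ⇒≡ x 0 x≡0 , ≡ᵇ⇒≡ y 1 y≡1)
... | inj₂ c′ with Equivalence.to T-∨ c′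
...   | inj₁ c₁₂ = let (x≡1 , y≡2) = Equivalence.to T-∧ c₁₂ in
  inj₂ (inj₁ (≡ᵇ⇒≡ x 1 x≡1 , ≡ᵇ⇒≡ y 2 y≡2))
...   | inj₂ cₒ  = let (2<x , rest) = Equivalence.to T-∧ cₒ ; (odd , y≡1+x) = Equivalence.to T-∧ rest in
  inj₂ (inj₂ (<ᵇ⇒< 2 x 2<x , ≡ᵇ⇒≡ (x % 2) 1 odd , ≡ᵇ⇒≡ y (suc x) y≡1+x))

complDir⇒≡suc : ∀ x y → T (complDir x y) → y ≡ suc x
complDir⇒≡suc x y c with complDir-spec x y c
... | inj₁ (refl , refl)              = refl
... | inj₂ (inj₁ (refl , refl))       = refl
... | inj₂ (inj₂ (_ , _ , y≡1+x))     = y≡1+x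

adjB-< : ∀ {x y} → x < y → ¬ T (complDir x y) → T (adjB x y)
adjB-< {x} {y} x<y ¬c
  rewrite ¬T⇒≡false (<⇒≢ x<y ∘ ≡ᵇ⇒≡ x y) | ¬T⇒≡false ¬c
        | ¬T⇒≡false (λ c → <-asym x<y (≤-reflexive (sym (complDir⇒≡suc y x c)))) = tt

adjB-gap : ∀ {x y} → suc x < y → T (adjB x y)
adjB-gap {x} {y} 1+x<y = adjB-< (<-trans (n<1+n x) 1+x<y) λ c → <-irrefl (sym (complDir⇒≡suc x y c)) 1+x<y

adjB-even-odd : ∀ j → T (adjB (2 + (j + j)) (3 + (j + j)))
adjB-even-odd j = adjB-< (n<1+n (2 + (j + j))) (not-compl ∘ complDir-spec (2 + (j + j)) (3 + (j + j)))
  where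
  even : (2 + (j + j)) % 2 ≡ 0
  even = trans (cong (_% 2) (trans (cong suc (sym (+-suc j j))) (n+n≡n*2 (suc j)))) (m*n%n≡0 (suc j) 2)
  not-compl : ¬ ((2 + (j + j) ≡ 0 × 3 + (j + j) ≡ 1) ⊎ (2 + (j + j) ≡ 1 × 3 + (j + j) ≡ 2) ⊎
                 (2 < 2 + (j + j) × (2 + (j + j)) % 2 ≡ 1 × 3 + (j + j) ≡ 3 + (j + j)))
  not-compl (inj₁ (() , _))
  not-compl (inj₂ (inj₁ (() , _)))
  not-compl (inj₂ (inj₂ (_ , odd , _))) = 0≢1+n (trans (sym even) odd)

odd-row-adj : ∀ j x → x < 3 + (j + j) → T (adjB x (3 + (j + j)))
odd-row-adj j x x<3+2j with m≤n⇒m<n∨m≡n (s≤s⁻¹ x<3+2j)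
... | inj₁ x<2+2j = adjB-gap (s≤s x<2+2j)
... | inj₂ refl   = adjB-even-odd j

even-row-adj : ∀ j x → x < 3 + (j + j) → T (adjB x (4 + (j + j)))
even-row-adj j x x<3+2j = adjB-gap (s≤s x<3+2j)

¬adjB-0-1 : ¬ T (adjB 0 1)
¬adjB-0-1 ()

adjB-1⇒3≤ : ∀ y → 1 < y → T (adjB 1 y) → 3 ≤ y
adjB-1⇒3≤ (suc (suc zero))    _ ()
adjB-1⇒3≤ (suc (suc (suc y))) _ _ = s≤s (s≤s (s≤s z≤n))

module B₂ₜ₊₁ (t : ℕ) where

  n : ℕ
  n = suc (t + t) + 2

  G : SimpleGraph n
  G = B (suc (t + t))

  edge : ∀ x y → x < y → y < n → T (adjB x y) → Edge G
  edge x y x<y y<n xy =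
    (fromℕ< x<n , fromℕ< y<n) ,
    subst₂ _<_ (sym (toℕ-fromℕ< x<n)) (sym (toℕ-fromℕ< y<n)) x<y ,
    subst₂ (λ a b → T (adjB a b)) (sym (toℕ-fromℕ< x<n)) (sym (toℕ-fromℕ< y<n)) xy
    where
    x<n : x < n
    x<n = <-trans x<y y<n

  adj-below : ∀ {y c} → (∀ x → x < suc c → T (adjB x y)) → ∀ x → x < c → T (adjB x y)
  adj-below adj x x<c = adj x (m<n⇒m<1+n x<c)

  row : ∀ y c → c ≤ y → y < n → (∀ x → x < c → T (adjB x y)) → List (Edge G)
  row y zero    _   _   _   = []
  row y (suc c) c<y y<n adj = edge c y c<y y<n (adj c ≤-refl) ∷ row y c (<⇒≤ c<y) y<n (adj-below adj)

  length-row : ∀ y c c≤y y<n adj → length (row y c c≤y y<n adj) ≡ c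
  length-row y zero    _   _   _   = refl
  length-row y (suc c) c<y y<n adj = cong suc (length-row y c (<⇒≤ c<y) y<n (adj-below adj))

  row-tgt : ∀ y c c≤y y<n adj → All (λ e → toℕ (tgt {G = G} e) ≡ y) (row y c c≤y y<n adj)
  row-tgt y zero    _   _   _   = []
  row-tgt y (suc c) c<y y<n adj = toℕ-fromℕ< _ ∷ row-tgt y c (<⇒≤ c<y) y<n (adj-below adj)

  row-src : ∀ y c c≤y y<n adj → All (λ e → toℕ (src {G = G} e) < c) (row y c c≤y y<n adj)
  row-src y zero    _   _   _   = []
  row-src y (suc c) c<y y<n adj =
    ≤-reflexive (cong suc (toℕ-fromℕ< _)) ∷ All.map m<n⇒m<1+n (row-src y c (<⇒≤ c<y) y<n (adj-below adj))

  row-unique : ∀ y c c≤y y<n adj → Unique (row y c c≤y y<n adj)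
  row-unique y zero    _   _   _   = []
  row-unique y (suc c) c<y y<n adj =
    All.map (λ src<c head≡e → <-irrefl (trans (sym (cong (toℕ ∘ src {G = G}) head≡e)) (toℕ-fromℕ< _)) src<c)
            (row-src y c (<⇒≤ c<y) y<n (adj-below adj)) ∷
    row-unique y c (<⇒≤ c<y) y<n (adj-below adj)

  4+2j<n : ∀ {j} → suc j ≤ t → 4 + (j + j) < n
  4+2j<n {j} j<t = s≤s (begin
    4 + (j + j)           ≡⟨ cong (2 +_) (+-suc (suc j) j) ⟨
    2 + (suc j + suc j)   ≡⟨ +-comm 2 (suc j + suc j) ⟩
    suc j + suc j + 2     ≤⟨ +-monoˡ-≤ 2 (+-mono-≤ j<t j<t) ⟩
    t + t + 2             ∎)
    where open ≤-Reasoning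

  oddRow evenRow : ∀ j → suc j ≤ t → List (Edge G)
  oddRow  j j<t = row (3 + (j + j)) (3 + (j + j)) ≤-refl (<-trans (n<1+n _) (4+2j<n j<t)) (odd-row-adj j)
  evenRow j j<t = row (4 + (j + j)) (3 + (j + j)) (n≤1+n _) (4+2j<n j<t) (even-row-adj j)

  length-oddRow : ∀ j j<t → length (oddRow j j<t) ≡ 3 + (j + j)
  length-oddRow j j<t = length-row _ _ _ _ (odd-row-adj j)

  length-evenRow : ∀ j j<t → length (evenRow j j<t) ≡ 3 + (j + j)
  length-evenRow j j<t = length-row _ _ _ _ (even-row-adj j)

  oddRow-tgt : ∀ j j<t → All (λ e → toℕ (tgt {G = G} e) ≡ 3 + (j + j)) (oddRow j j<t)
  oddRow-tgt j j<t = row-tgt _ _ _ _ (odd-row-adj j)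

  evenRow-tgt : ∀ j j<t → All (λ e → toℕ (tgt {G = G} e) ≡ 4 + (j + j)) (evenRow j j<t)
  evenRow-tgt j j<t = row-tgt _ _ _ _ (even-row-adj j)

  2<n : 2 < n
  2<n = s≤s (m≤n+m 2 (t + t))

  edgeList : ∀ j → j ≤ t → List (Edge G)
  edgeList zero    _   = edge 0 2 (s≤s z≤n) 2<n tt ∷ []
  edgeList (suc j) j<t = oddRow j j<t ++ evenRow j j<t ++ edgeList j (<⇒≤ j<t)

  length-edgeList : ∀ j j≤t → length (edgeList j j≤t) ≡ suc ((j + j) * suc (suc j))
  length-edgeList zero    _   = refl
  length-edgeList (suc j) j<t = begin
    length (oddRow j j<t ++ evenRow j j<t ++ edgeList j (<⇒≤ j<t))
      ≡⟨ length-++ (oddRow j j<t) ⟩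
    length (oddRow j j<t) + length (evenRow j j<t ++ edgeList j (<⇒≤ j<t))
      ≡⟨ cong (length (oddRow j j<t) +_) (length-++ (evenRow j j<t)) ⟩
    length (oddRow j j<t) + (length (evenRow j j<t) + length (edgeList j (<⇒≤ j<t)))
      ≡⟨ cong₂ (λ a b → a + (b + length (edgeList j (<⇒≤ j<t)))) (length-oddRow j j<t) (length-evenRow j j<t) ⟩
    3 + (j + j) + (3 + (j + j) + length (edgeList j (<⇒≤ j<t)))
      ≡⟨ cong (λ l → 3 + (j + j) + (3 + (j + j) + l)) (length-edgeList j (<⇒≤ j<t)) ⟩
    3 + (j + j) + (3 + (j + j) + suc ((j + j) * suc (suc j)))
      ≡⟨ count-step j ⟩
    suc ((suc j + suc j) * suc (suc (suc j))) ∎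
    where
    open ≡-Reasoning
    count-step : ∀ j → 3 + (j + j) + (3 + (j + j) + suc ((j + j) * suc (suc j))) ≡ suc ((suc j + suc j) * suc (suc (suc j)))
    count-step = solve-∀

  edgeList-tgt : ∀ j j≤t → All (λ e → toℕ (tgt {G = G} e) ≤ 2 + (j + j)) (edgeList j j≤t)
  edgeList-tgt zero    _   = ≤-reflexive (toℕ-fromℕ< 2<n) ∷ []
  edgeList-tgt (suc j) j<t =
    All.++⁺ (All.map (λ eq → ≤-trans (≤-reflexive eq) (≤-trans (n≤1+n _) 4+2j≤)) (oddRow-tgt j j<t))
      (All.++⁺ (All.map (λ eq → ≤-trans (≤-reflexive eq) 4+2j≤) (evenRow-tgt j j<t))
               (All.map (λ le → ≤-trans le (≤-trans (n≤1+n _) (≤-trans (n≤1+n _) 4+2j≤)))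
                        (edgeList-tgt j (<⇒≤ j<t))))
    where
    4+2j≤ : 4 + (j + j) ≤ 2 + (suc j + suc j)
    4+2j≤ = ≤-reflexive (cong (3 +_) (sym (+-suc j j)))

  edgeList-unique : ∀ j j≤t → Unique (edgeList j j≤t)
  edgeList-unique zero    _   = [] ∷ []
  edgeList-unique (suc j) j<t =
    AllPairs.++⁺ (row-unique _ _ _ _ (odd-row-adj j))
      (AllPairs.++⁺ (row-unique _ _ _ _ (even-row-adj j)) (edgeList-unique j (<⇒≤ j<t))
        (All-All-≢ tgtℕ (evenRow-tgt j j<t) (All.map (λ le → <⇒≢ (s≤s (≤-trans le (n≤1+n _)))) earlier) distinct))
      (All-All-≢ tgtℕ (oddRow-tgt j j<t)
        (All.++⁺ (All.map (λ eq → >⇒≢ (≤-reflexive (sym eq))) (evenRow-tgt j j<t))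
                 (All.map (λ le → <⇒≢ (s≤s le)) earlier))
        distinct)
    where
    tgtℕ : Edge G → ℕ
    tgtℕ = toℕ ∘ tgt {G = G}
    earlier : All (λ e → tgtℕ e ≤ 2 + (j + j)) (edgeList j (<⇒≤ j<t))
    earlier = edgeList-tgt j (<⇒≤ j<t)
    distinct : ∀ {y a b} → a ≡ y → b ≢ y → a ≢ b
    distinct refl b≢a a≡b = b≢a (sym a≡b)

  edge-count : ∀ {m} (ℓ : Ordering G m) → suc ((t + t) * suc (suc t)) ≤ m
  edge-count {m} ℓ = subst (_≤ m) (length-edgeList t ≤-refl) (Unique-length≤ordering {G = G} ℓ (edgeList-unique t ≤-refl))

  matchEdge : 1 ≤ t → ∀ c → c ≤ t → Edge G
  matchEdge 1≤t c c≤t = edge c (c + suc t) (m<m+n c (s≤s z≤n)) c+1+t<n (adjB-gap 1+c<c+1+t)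
    where
    1+c<c+1+t : suc c < c + suc t
    1+c<c+1+t = subst (_≤ c + suc t) (+-comm c 2) (+-monoʳ-≤ c (s≤s 1≤t))
    c+1+t<n : c + suc t < n
    c+1+t<n = begin-strict
      c + suc t       ≤⟨ +-monoˡ-≤ (suc t) c≤t ⟩
      t + suc t       ≡⟨ +-suc t t ⟩
      suc (t + t)     <⟨ m<m+n (suc (t + t)) (s≤s z≤n) ⟩
      suc (t + t) + 2 ∎
      where open ≤-Reasoning

  matching : 1 ≤ t → ∀ c → c ≤ suc t → List (Edge G)
  matching _   zero    _     = []
  matching 1≤t (suc c) c<1+t = matchEdge 1≤t c (s≤s⁻¹ c<1+t) ∷ matching 1≤t c (<⇒≤ c<1+t)

  length-matching : ∀ 1≤t c c≤1+t → length (matching 1≤t c c≤1+t) ≡ c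
  length-matching 1≤t zero    _     = refl
  length-matching 1≤t (suc c) c<1+t = cong suc (length-matching 1≤t c (<⇒≤ c<1+t))

  matching-endpoints : ∀ 1≤t c c≤1+t →
    All (λ e → toℕ (src {G = G} e) < c × toℕ (tgt {G = G} e) ≡ toℕ (src {G = G} e) + suc t) (matching 1≤t c c≤1+t)
  matching-endpoints 1≤t zero    _     = []
  matching-endpoints 1≤t (suc c) c<1+t =
    (≤-reflexive (cong suc src≡c) , trans (toℕ-fromℕ< _) (cong (_+ suc t) (sym src≡c))) ∷
    All.map (λ (i<c , tgt≡) → m<n⇒m<1+n i<c , tgt≡) (matching-endpoints 1≤t c (<⇒≤ c<1+t))
    where
    src≡c : toℕ (src {G = G} (matchEdge 1≤t c (s≤s⁻¹ c<1+t))) ≡ c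
    src≡c = toℕ-fromℕ< _

  matching-isMatching : ∀ 1≤t c c≤1+t → IsMatching {G = G} (matching 1≤t c c≤1+t)
  matching-isMatching 1≤t zero    _     = []
  matching-isMatching 1≤t (suc c) c<1+t =
    All.map (λ {e} (i<c , tgt≡) → Disjoint-sym {G = G} {e} {head}
      (Disjoint-crossing {G = G} {e} {head}
        (subst (_ <_) (sym src≡c) i<c)
        (subst₂ _<_ (sym src≡c) (sym tgt≡) (<-≤-trans (s≤s c≤t) (m≤n+m (suc t) _)))
        (subst₂ _<_ (sym tgt≡) (sym tgt≡c+1+t) (+-monoˡ-< (suc t) i<c))))
      (matching-endpoints 1≤t c (<⇒≤ c<1+t)) ∷
    matching-isMatching 1≤t c (<⇒≤ c<1+t)
    where
    c≤t : c ≤ t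
    c≤t = s≤s⁻¹ c<1+t
    head : Edge G
    head = matchEdge 1≤t c c≤t
    src≡c : toℕ (src {G = G} head) ≡ c
    src≡c = toℕ-fromℕ< _
    tgt≡c+1+t : toℕ (tgt {G = G} head) ≡ c + suc t
    tgt≡c+1+t = toℕ-fromℕ< _

  one : Fin n
  one = fromℕ< (<-trans (n<1+n 1) 2<n)

  toℕ-one : toℕ one ≡ 1
  toℕ-one = toℕ-fromℕ< (<-trans (n<1+n 1) 2<n)

  incident-one : ∀ e → Incident {G = G} one e → src {G = G} e ≡ one × 3 ≤ toℕ (tgt {G = G} e)
  incident-one ((a , b) , a<b , ab) (inj₁ one≡a) =
    sym one≡a , adjB-1⇒3≤ (toℕ b) (subst (_< toℕ b) a≡1 a<b) (subst (λ x → T (adjB x (toℕ b))) a≡1 ab)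
    where
    a≡1 : toℕ a ≡ 1
    a≡1 = trans (cong toℕ (sym one≡a)) toℕ-one
  incident-one ((a , b) , a<b , ab) (inj₂ one≡b) =
    ⊥-elim (¬adjB-0-1 (subst₂ (λ x y → T (adjB x y)) (n<1⇒n≡0 (subst (toℕ a <_) b≡1 a<b)) b≡1 ab))
    where
    b≡1 : toℕ b ≡ 1
    b≡1 = trans (cong toℕ (sym one≡b)) toℕ-one

  degree-one : ∀ {es} → Unique es → All (Incident {G = G} one) es → length es ≤ t + t
  degree-one {es} unique incident =
    +-cancelˡ-≤ 3 _ _ (subst₂ _≤_ (cong (3 +_) (length-map (tgt {G = G}) es)) (+-comm (suc (t + t)) 2)
                                  (Unique-length≤ vs-unique))
    where
    0<3 : 0 < 3
    0<3 = s≤s z≤n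
    1<3 : 1 < 3
    1<3 = s≤s (s≤s z≤n)
    2<3 : 2 < 3
    2<3 = ≤-refl

    low : ∀ x → x < 3 → Fin n
    low x x<3 = fromℕ< (<-≤-trans x<3 2<n)

    toℕ-low : ∀ x x<3 → toℕ (low x x<3) ≡ x
    toℕ-low x x<3 = toℕ-fromℕ< (<-≤-trans x<3 2<n)

    low-≢ : ∀ x x<3 y y<3 → x ≢ y → low x x<3 ≢ low y y<3
    low-≢ x x<3 y y<3 x≢y eq = x≢y (trans (sym (toℕ-low x x<3)) (trans (cong toℕ eq) (toℕ-low y y<3)))

    ends : All (λ e → src {G = G} e ≡ one × 3 ≤ toℕ (tgt {G = G} e)) es
    ends = All.map (λ {e} → incident-one e) incident

    low∉tgts : ∀ x x<3 → All (low x x<3 ≢_) (map (tgt {G = G}) es)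
    low∉tgts x x<3 = All.map⁺ (All.map
      (λ (_ , 3≤) eq → <⇒≱ x<3 (subst (3 ≤_) (trans (cong toℕ (sym eq)) (toℕ-low x x<3)) 3≤)) ends)

    tgts-unique : Unique (map (tgt {G = G}) es)
    tgts-unique = AllPairs.map⁺ (AllPairs-map-within
      (λ (a≡one , _) (b≡one , _) a≢b tgt≡ → a≢b (Edge-≡ {G = G} (trans a≡one (sym b≡one)) tgt≡)) ends unique)

    vs : List (Fin n)
    vs = low 0 0<3 ∷ low 1 1<3 ∷ low 2 2<3 ∷ map (tgt {G = G}) es

    vs-unique : Unique vs
    vs-unique =
      (low-≢ 0 0<3 1 1<3 (λ ()) ∷ low-≢ 0 0<3 2 2<3 (λ ()) ∷ low∉tgts 0 0<3) ∷
      (low-≢ 1 1<3 2 2<3 (λ ()) ∷ low∉tgts 1 1<3) ∷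
      low∉tgts 2 2<3 ∷
      tgts-unique

  n≡1+[1+t]+[1+t] : n ≡ suc (suc t + suc t)
  n≡1+[1+t]+[1+t] = lemma t
    where
    lemma : ∀ t → suc (t + t) + 2 ≡ suc (suc t + suc t)
    lemma = solve-∀

  ¬separated : 1 ≤ t → ∀ {m} (ℓ : Ordering G (suc m)) → ¬ Separated {G = G} ℓ (suc t)
  ¬separated 1≤t {m} ℓ sep =
    let es , unique , incident , length≡ = incident-edges (≤-reflexive n≡1+[1+t]+[1+t]) (t + t) count one
    in <-irrefl refl (subst (_≤ t + t) length≡ (degree-one unique incident))
    where
    count : (t + t) * suc (suc t) < suc m
    count = edge-count ℓ

    2+t≤count : suc (suc t) ≤ (t + t) * suc (suc t)
    2+t≤count = subst (_≤ (t + t) * suc (suc t)) (*-identityˡ (suc (suc t)))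
                      (*-monoˡ-≤ (suc (suc t)) (≤-trans 1≤t (m≤m+n t t)))

    open Window {G = G} ℓ sep (s≤s z≤n) (<-trans (<-≤-trans (n<1+n (suc t)) 2+t≤count) count)

  cms-bound : 1 ≤ t → CmsAtMost G t
  cms-bound 1≤t zero    ℓ s 1≤s s≤0 _ = contradiction (≤-trans 1≤s s≤0) λ ()
  cms-bound 1≤t (suc m) ℓ s _   _   sep with s ≤? t
  ... | yes s≤t = s≤t
  ... | no  s≰t = contradiction (Separated-mono {G = G} {ℓ = ℓ} (≰⇒> s≰t) sep) (¬separated 1≤t ℓ)

  matching-number : 1 ≤ t → MatchingNumber G (suc t)
  matching-number 1≤t =
    (matching 1≤t (suc t) ≤-refl , matching-isMatching 1≤t (suc t) ≤-refl , length-matching 1≤t (suc t) ≤-refl) ,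
    λ es isMatching → m+m≤1+n+n⇒m≤n (length es) (suc t)
      (subst (length es + length es ≤_) n≡1+[1+t]+[1+t] (IsMatching⇒length≤ {G = G} isMatching))

odd⇒≡1+n+n : ∀ k → k % 2 ≡ 1 → ∃[ t ] k ≡ suc (t + t)
odd⇒≡1+n+n k k%2≡1 = k / 2 , trans (m≡m%n+[m/n]*n k 2) (cong₂ _+_ k%2≡1 (sym (n+n≡n*2 (k / 2))))

[n+n]/2≡n : ∀ n → (n + n) / 2 ≡ n
[n+n]/2≡n n = trans (cong (_/ 2) (n+n≡n*2 n)) (m*n/n≡m n 2)

lemma4p3 : (k : ℕ) → 3 ≤ k → k % 2 ≡ 1 →
    CmsAtMost (B k) ((k ∸ 1) / 2) × MatchingNumber (B k) ((k + 1) / 2)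
lemma4p3 k 3≤k k-odd with odd⇒≡1+n+n k k-odd
... | zero  , refl = contradiction 3≤k λ { (s≤s ()) }
... | suc t , refl =
  subst (CmsAtMost G) (sym ([n+n]/2≡n (suc t))) (cms-bound (s≤s z≤n)) ,
  subst (MatchingNumber G) (sym (trans (cong (_/ 2) k+1≡) ([n+n]/2≡n (suc (suc t))))) (matching-number (s≤s z≤n))
  where
  open B₂ₜ₊₁ (suc t)
  k+1≡ : suc (suc t + suc t) + 1 ≡ suc (suc t) + suc (suc t)
  k+1≡ = trans (+-comm _ 1) (cong suc (sym (+-suc (suc t) (suc t))))
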